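{- There is a quantifier-free deletion query $\rho$ with one parameter such that $(q_{\text{Reach}},\Delta_{E}\cup\{\rho\})$ cannot be maintained in $\mathrm{DynProp}$.
   Context: Graphs are structures with one binary edge relation $E$. A deletion query for $E$ with parameter tuple $\bar p$ is given by a formula $\mu(\bar p;x,y)=E(x,y)\land\varphi(\bar p,x,y)$; it is quantifier-free if $\varphi$ is. A change $\rho(\bar a)$ maps a graph $G$ to the graph with edge set $\{(b,c)\mid G\models\mu(\bar a;b,c)\}$. $\Delta_E$ consists of the single-edge insertion $\mathrm{insert}_E(\bar p)$ with $\mu=E(x,y)\lor (x,y)=(p_1,p_2)$ and single-edge deletion $\mathrm{delete}_E(\bar p)$ with $\mu=E(x,y)\land\neg((x,y)=(p_1,p_2))$. Dynamic programs: states consist of the input graph and auxiliary relations over the same fixed finite domain; for each allowed change query $\rho(\bar p)$ and auxiliary relation $T$ there is an update formula $\varphi^\rho_T(\bar p;\bar x)$; after change $\rho(\bar a)$ the input becomes $\rho(\bar a)(G)$ and $T$ becomes $\{\bar b\mid\text{old state}\models\varphi^\rho_T(\bar a;\bar b)\}$. The program maintains $(q,\Delta)$ if a designated auxiliary relation $Q$ equals $q$ of the current input after every non-empty change sequence from $\Delta$ applied to the empty graph and empty auxiliary database. $\mathrm{DynProp}$: quantifier-free update formulas. $q_{\text{Reach}}$ maps a graph to the set of pairs $(u,v)$ with a directed path from $u$ to $v$. -}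

module Defs where

open import Data.Nat using (ℕ; suc)
open import Data.Fin using (Fin; zero; suc; _≟_)
open import Data.Bool using (Bool; true; false; _∧_; _∨_; not)
open import Data.Unit using (⊤; tt)
open import Data.Sum using (_⊎_; inj₁; inj₂; [_,_])
open import Data.Product using (Σ; _×_; _,_)
open import Data.List using (List; []; _∷_)
open import Relation.Nullary.Decidable using (⌊_⌋)
open import Relation.Binary.PropositionalEquality using (_≡_; _≢_)

data QF {S : Set} (ar : S → ℕ) (V : Set) : Set where
  rel   : (R : S) → (Fin (ar R) → V) → QF ar V
  _≐_   : V → V → QF ar V
  tt'   : QF ar V
  ff'   : QF ar V
  ¬'_   : QF ar V → QF ar V
  _∧'_  : QF ar V → QF ar V → QF ar V
  _∨'_  : QF ar V → QF ar V → QF ar V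

Interp : {S : Set} → (S → ℕ) → ℕ → Set
Interp {S} ar n = (R : S) → (Fin (ar R) → Fin n) → Bool

⟦_⟧ : {S : Set} {ar : S → ℕ} {V : Set} {n : ℕ} →
      QF ar V → Interp ar n → (V → Fin n) → Bool
⟦ rel R ts ⟧ I α = I R (λ i → α (ts i))
⟦ x ≐ y ⟧ I α = ⌊ α x ≟ α y ⌋
⟦ tt' ⟧ I α = true
⟦ ff' ⟧ I α = false
⟦ ¬' φ ⟧ I α = not (⟦ φ ⟧ I α)
⟦ φ ∧' ψ ⟧ I α = ⟦ φ ⟧ I α ∧ ⟦ ψ ⟧ I α
⟦ φ ∨' ψ ⟧ I α = ⟦ φ ⟧ I α ∨ ⟦ ψ ⟧ I α

GSym : Set
GSym = ⊤

gar : GSym → ℕ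
gar _ = 2

Graph : ℕ → Set
Graph n = Interp gar n

pair : {A : Set} → A → A → Fin 2 → A
pair a b zero = a
pair a b (suc _) = b

xv yv : {p : ℕ} → Fin p ⊎ Fin 2
xv = inj₂ zero
yv = inj₂ (suc zero)

pv : {p : ℕ} → Fin p → Fin p ⊎ Fin 2
pv i = inj₁ i

E[_,_] : {V : Set} → V → V → QF gar V
E[ a , b ] = rel tt (pair a b)

record ChangeQuery : Set where
  field
    params : ℕ
    μ      : QF gar (Fin params ⊎ Fin 2)
open ChangeQuery public

applyChange : {n : ℕ} (ρ : ChangeQuery) → (Fin (params ρ) → Fin n) →
              Graph n → Graph n
applyChange ρ a G _ t = ⟦ μ ρ ⟧ G [ a , t ]

deletionQuery : (p : ℕ) → QF gar (Fin p ⊎ Fin 2) → ChangeQuery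
deletionQuery p φ = record { params = p ; μ = E[ xv , yv ] ∧' φ }

insertE : ChangeQuery
insertE = record
  { params = 2
  ; μ = E[ xv , yv ] ∨' ((xv ≐ pv zero) ∧' (yv ≐ pv (suc zero))) }

deleteE : ChangeQuery
deleteE = record
  { params = 2
  ; μ = E[ xv , yv ] ∧' (¬' ((xv ≐ pv zero) ∧' (yv ≐ pv (suc zero)))) }

data ΔIdx : Set where
  ins del rho : ΔIdx

ΔEρ : ChangeQuery → ΔIdx → ChangeQuery
ΔEρ ρ ins = insertE
ΔEρ ρ del = deleteE
ΔEρ ρ rho = ρ

data Reach {n : ℕ} (G : Graph n) : Fin n → Fin n → Set where
  here : ∀ {u} → Reach G u u
  step : ∀ {u w v} → G tt (pair u w) ≡ true → Reach G w v → Reach G u v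

data PSym (k : ℕ) : Set where
  E Q : PSym k
  A   : Fin k → PSym k

par : {k : ℕ} → (Fin k → ℕ) → PSym k → ℕ
par ar E = 2
par ar Q = 2
par ar (A i) = ar i

data AuxSym (k : ℕ) : Set where
  Qa : AuxSym k
  Aa : Fin k → AuxSym k

aux→sym : {k : ℕ} → AuxSym k → PSym k
aux→sym Qa = Q
aux→sym (Aa i) = A i

record DynPropProgram {I : Set} (Δ : I → ChangeQuery) : Set where
  field
    k   : ℕ
    ar  : Fin k → ℕ
    upd : (c : I) (T : AuxSym k) →
          QF (par ar) (Fin (params (Δ c)) ⊎ Fin (par ar (aux→sym T)))
open DynPropProgram public

State : {I : Set} {Δ : I → ChangeQuery} → DynPropProgram Δ → ℕ → Set
State P n = Interp (par (ar P)) n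

inputOf : {I : Set} {Δ : I → ChangeQuery} {P : DynPropProgram Δ} {n : ℕ} →
          State P n → Graph n
inputOf S _ t = S E t

initState : {I : Set} {Δ : I → ChangeQuery} (P : DynPropProgram Δ) (n : ℕ) →
            State P n
initState P n _ _ = false

record Change {I : Set} (Δ : I → ChangeQuery) (n : ℕ) : Set where
  constructor chg
  field
    which : I
    args  : Fin (params (Δ which)) → Fin n

applyStep : {I : Set} {Δ : I → ChangeQuery} (P : DynPropProgram Δ) {n : ℕ} →
            Change Δ n → State P n → State P n
applyStep {Δ = Δ} P (chg c a) S E t = applyChange (Δ c) a (inputOf {P = P} S) tt t
applyStep P (chg c a) S Q t = ⟦ upd P c Qa ⟧ S [ a , t ]
applyStep P (chg c a) S (A i) t = ⟦ upd P c (Aa i) ⟧ S [ a , t ]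

run : {I : Set} {Δ : I → ChangeQuery} (P : DynPropProgram Δ) {n : ℕ} →
      List (Change Δ n) → State P n → State P n
run P [] S = S
run P (c ∷ cs) S = run P cs (applyStep P c S)

MaintainsReach : {I : Set} {Δ : I → ChangeQuery} → DynPropProgram Δ → Set
MaintainsReach P =
  ∀ (n : ℕ) (cs : List (Change _ n)) → cs ≢ [] →
  let S = run P cs (initState P n) in
  ∀ (u v : Fin n) →
    (S Q (pair u v) ≡ true → Reach (inputOf {P = P} S) u v) ×
    (Reach (inputOf {P = P} S) u v → S Q (pair u v) ≡ true)

DynPropMaintainable : {I : Set} → (I → ChangeQuery) → Set
DynPropMaintainable Δ = Σ (DynPropProgram Δ) λ P → MaintainsReach P

module Submission where

-- The proof is a fooling argument.  The universe consists of a core of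
-- m = 2c + 1 vertices (a target and vertices (i , b) for digit positions i < c
-- and bits b) and G = 2 ^ c gadgets; (i , b) points to the gadgets whose i-th
-- binary digit is b, and every gadget of a chosen set β points to the target.
-- Applying ρ₀ at the c core vertices carrying the digits opposite to those of
-- a gadget g₀ deletes every gadget→target edge except that of g₀, so the
-- target becomes reachable from the core vertex (0 , digit of g₀) iff g₀ ∈ β.
-- Quantifier-free updates whose parameters lie in the core only see the core,
-- so this answer is determined by the core part of the state reached after
-- building the graph.  That part has at most (2 ^ m ^ r) ^ a values (a symbols,
-- arities ≤ r), fewer than the 2 ^ G choices of β once c is large, so the
-- program confuses two different β.

open import Defs
open import Data.Fin using (Fin)
open import Data.Sum using (_⊎_)
open import Data.Product using (Σ)
open import Relation.Nullary using (¬_)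

open import Data.Nat using (ℕ; zero; suc; _+_; _*_; _^_; _≤_; _<_; z≤n; s≤s)
open import Data.Nat.Properties
  using (≤-trans; <⇒≤; m≤m+n; m≤n+m; +-mono-≤; +-monoʳ-≤; *-mono-≤; *-monoʳ-≤;
         *-monoʳ-<; *-monoˡ-<; ^-monoˡ-≤; ^-monoʳ-≤; ^-monoʳ-<; ^-*-assoc;
         ^-distribˡ-+-*; m^n>0; m^n≢0; module ≤-Reasoning)
open import Data.Nat.Solver using (module +-*-Solver)
open import Data.Fin using (zero; suc; _≟_; _↑ˡ_; _↑ʳ_; splitAt; inject≤; finToFun; funToFin; combine)
open import Data.Fin.Properties
  using (splitAt-↑ˡ; splitAt-↑ʳ; funToFin-finToFin; finToFun-funToFin; pigeonhole; <⇒≢)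
open import Data.Bool using (Bool; true; false; _∧_; _∨_; not; if_then_else_)
open import Data.Bool.Properties using (∧-identityʳ; ∧-zeroʳ; ∨-identityʳ; ∨-zeroʳ)
  renaming (_≟_ to _≟ᵇ_)
open import Data.Unit using (⊤; tt)
open import Data.Empty using (⊥; ⊥-elim)
open import Data.Sum using (inj₁; inj₂; [_,_]; [_,_]′)
open import Data.Product using (_×_; _,_; proj₁; proj₂)
open import Data.List using (List; []; _∷_; _++_; map; allFin; cartesianProduct)
open import Data.List.Properties using (++-conicalˡ)
open import Data.List.Membership.Propositional using (_∈_)
open import Data.List.Membership.Propositional.Properties using (∈-cartesianProduct⁺; ∈-allFin)
open import Data.List.Relation.Unary.Any using (here; there)
open import Data.List.Relation.Unary.All using (All; []; _∷_; universal)
open import Relation.Nullary.Decidable using (⌊_⌋; yes; no)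
open import Relation.Binary.PropositionalEquality
  using (_≡_; _≢_; refl; sym; trans; cong; cong₂; subst; module ≡-Reasoning)
open +-*-Solver using (solve; _:+_; _:*_; con; _:=_)

-- Arithmetic: polynomials are eventually dominated by exponentials.

n<2^n : ∀ n → n < 2 ^ n
n<2^n zero = s≤s z≤n
n<2^n (suc n) = +-mono-≤ (m^n>0 2 n) (≤-trans (n<2^n n) (m≤m+n (2 ^ n) 0))

linear<exponential : ∀ K → K * suc (suc (K + K)) < 2 ^ suc (K + K)
linear<exponential K = begin-strict
  K * suc (suc (K + K))
    ≡⟨ solve 1 (λ K → K :* (con 2 :+ (K :+ K)) := con 2 :* (K :* (con 1 :+ K))) refl K ⟩
  2 * (K * suc K)        <⟨ *-monoʳ-< 2 K*sK<4^K ⟩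
  2 * (2 ^ K * 2 ^ K)    ≡⟨ cong (2 *_) (sym (^-distribˡ-+-* 2 K K)) ⟩
  2 ^ suc (K + K)        ∎
  where
  open ≤-Reasoning
  K*sK<4^K : K * suc K < 2 ^ K * 2 ^ K
  K*sK<4^K = begin-strict
    K * suc K    ≤⟨ *-monoʳ-≤ K (n<2^n K) ⟩
    K * 2 ^ K    <⟨ *-monoˡ-< (2 ^ K) {{m^n≢0 2 K}} (n<2^n K) ⟩
    2 ^ K * 2 ^ K ∎

-- The form used for counting: some c = suc c′ has (2c + 1) ^ r · a < 2 ^ c.
-- With c = 2 ^ t + 1 the left side is at most 2 ^ ((3 + t) r + a), and the
-- exponent is linear in t.
polynomial<exponential : ∀ a r → Σ ℕ λ c′ → suc (suc c′ + suc c′) ^ r * a < 2 ^ suc c′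
polynomial<exponential a r = 2 ^ t , (begin-strict
  suc (c + c) ^ r * a          ≤⟨ *-mono-≤ (^-monoˡ-≤ r 2c+1≤2^[3+t]) (<⇒≤ (n<2^n a)) ⟩
  (2 ^ (3 + t)) ^ r * 2 ^ a    ≡⟨ cong (_* 2 ^ a) (^-*-assoc 2 (3 + t) r) ⟩
  2 ^ ((3 + t) * r) * 2 ^ a    ≡⟨ sym (^-distribˡ-+-* 2 ((3 + t) * r) a) ⟩
  2 ^ ((3 + t) * r + a)        ≤⟨ ^-monoʳ-≤ 2 exponent-bound ⟩
  2 ^ (K * suc t)              <⟨ ^-monoʳ-< 2 (s≤s (s≤s z≤n)) (linear<exponential K) ⟩
  2 ^ 2 ^ t                    ≤⟨ m≤m+n (2 ^ 2 ^ t) _ ⟩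
  2 ^ c                        ∎)
  where
  open ≤-Reasoning
  K = a + 3 * r
  t = suc (K + K)
  c = suc (2 ^ t)
  2c+1≤2^[3+t] : suc (c + c) ≤ 2 ^ (3 + t)
  2c+1≤2^[3+t] = begin
    suc (c + c)
      ≡⟨ solve 1 (λ x → con 1 :+ ((con 1 :+ x) :+ (con 1 :+ x)) := con 2 :* x :+ con 3) refl (2 ^ t) ⟩
    2 * 2 ^ t + 3            ≤⟨ +-monoʳ-≤ (2 * 2 ^ t) (*-monoʳ-≤ 3 (m^n>0 2 t)) ⟩
    2 * 2 ^ t + 3 * 2 ^ t    ≤⟨ m≤m+n _ (3 * 2 ^ t) ⟩
    2 * 2 ^ t + 3 * 2 ^ t + 3 * 2 ^ t
      ≡⟨ solve 1 (λ x → con 2 :* x :+ con 3 :* x :+ con 3 :* x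
                       := con 2 :* (con 2 :* (con 2 :* x))) refl (2 ^ t) ⟩
    2 ^ (3 + t)              ∎
  exponent-bound : (3 + t) * r + a ≤ K * suc t
  exponent-bound = begin
    (3 + t) * r + a                        ≤⟨ m≤m+n _ (a * t + 2 * r * t) ⟩
    (3 + t) * r + a + (a * t + 2 * r * t)
      ≡⟨ solve 3 (λ a r t → (con 3 :+ t) :* r :+ a :+ (a :* t :+ con 2 :* r :* t)
                           := (a :+ con 3 :* r) :* (con 1 :+ t)) refl a r t ⟩
    K * suc t                              ∎

fewer-codes : ∀ x a y → x * a < y → (2 ^ x) ^ a < 2 ^ y
fewer-codes x a y x*a<y = subst (_< 2 ^ y) (sym (^-*-assoc 2 x a)) (^-monoʳ-< 2 (s≤s (s≤s z≤n)) x*a<y)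

upper-bound : ∀ k (f : Fin k → ℕ) → Σ ℕ λ b → ∀ i → f i ≤ b
upper-bound zero f = 0 , λ ()
upper-bound (suc k) f with upper-bound k (λ i → f (suc i))
... | b , bounds = f zero + b , λ { zero → m≤m+n (f zero) b
                                   ; (suc i) → ≤-trans (bounds i) (m≤n+m b (f zero)) }

toBit : Bool → Fin 2
toBit false = zero
toBit true = suc zero

fromBit : Fin 2 → Bool
fromBit zero = false
fromBit (suc zero) = true

toBit-injective : ∀ {b b′} → toBit b ≡ toBit b′ → b ≡ b′
toBit-injective {false} {false} _ = refl
toBit-injective {true} {true} _ = refl
toBit-injective {false} {true} ()
toBit-injective {true} {false} ()

fromBit-injective : ∀ {x y} → fromBit x ≡ fromBit y → x ≡ y
fromBit-injective {zero} {zero} _ = refl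
fromBit-injective {suc zero} {suc zero} _ = refl
fromBit-injective {zero} {suc zero} ()
fromBit-injective {suc zero} {zero} ()

funToFin-injective : ∀ {k m} {f g : Fin k → Fin m} → funToFin f ≡ funToFin g → ∀ i → f i ≡ g i
funToFin-injective {f = f} {g} same i =
  trans (sym (finToFun-funToFin f i))
        (trans (cong (λ w → finToFun w i) same) (finToFun-funToFin g i))

funToFin-cong : ∀ {k m} {f g : Fin k → Fin m} → (∀ i → f i ≡ g i) → funToFin f ≡ funToFin g
funToFin-cong {zero} f≗g = refl
funToFin-cong {suc k} f≗g = cong₂ combine (f≗g zero) (funToFin-cong (λ i → f≗g (suc i)))

finToFun-injective : ∀ {k m} {w w′ : Fin (m ^ k)} →
                     (∀ i → finToFun {m} {k} w i ≡ finToFun w′ i) → w ≡ w′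
finToFun-injective {k} {m} {w} {w′} same =
  trans (sym (funToFin-finToFin {k} {m} w))
        (trans (funToFin-cong {k} {m} same) (funToFin-finToFin {k} {m} w′))

extend : {A : Set} {k r : ℕ} → k ≤ r → A → (Fin k → A) → Fin r → A
extend z≤n a₀ s j = a₀
extend (s≤s k≤r) a₀ s zero = s zero
extend (s≤s k≤r) a₀ s (suc j) = extend k≤r a₀ (λ i → s (suc i)) j

extend-inject≤ : {A : Set} {k r : ℕ} (k≤r : k ≤ r) (a₀ : A) (s : Fin k → A) (i : Fin k) →
                 extend k≤r a₀ s (inject≤ i k≤r) ≡ s i
extend-inject≤ (s≤s k≤r) a₀ s zero = refl
extend-inject≤ (s≤s k≤r) a₀ s (suc i) = extend-inject≤ k≤r a₀ (λ i → s (suc i)) i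

InImage : {k n : ℕ} → (Fin k → Fin n) → Fin n → Set
InImage {k} emb x = Σ (Fin k) λ y → emb y ≡ x

-- Locality of quantifier-free formulas.

Coincide : {S : Set} {ar : S → ℕ} {n : ℕ} → (Fin n → Set) → Interp ar n → Interp ar n → Set
Coincide {S} {ar} {n} X I I′ =
  (R : S) {t t′ : Fin (ar R) → Fin n} →
  (∀ i → t i ≡ t′ i) → (∀ i → X (t i)) → I R t ≡ I′ R t′

Extensional : {S : Set} {ar : S → ℕ} {n : ℕ} → Interp ar n → Set
Extensional I = Coincide (λ _ → ⊤) I I

eval-coincide : {S : Set} {ar : S → ℕ} {V : Set} {n : ℕ} (X : Fin n → Set) {I I′ : Interp ar n}
                (φ : QF ar V) → Coincide X I I′ → {α β : V → Fin n} →
                (∀ v → α v ≡ β v) → (∀ v → X (α v)) → ⟦ φ ⟧ I α ≡ ⟦ φ ⟧ I′ β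
eval-coincide X (rel R ts) co α≗β αX = co R (λ i → α≗β (ts i)) (λ i → αX (ts i))
eval-coincide X (x ≐ y) co α≗β αX = cong₂ (λ a b → ⌊ a ≟ b ⌋) (α≗β x) (α≗β y)
eval-coincide X tt' co α≗β αX = refl
eval-coincide X ff' co α≗β αX = refl
eval-coincide X (¬' φ) co α≗β αX = cong not (eval-coincide X φ co α≗β αX)
eval-coincide X (φ ∧' ψ) co α≗β αX =
  cong₂ _∧_ (eval-coincide X φ co α≗β αX) (eval-coincide X ψ co α≗β αX)
eval-coincide X (φ ∨' ψ) co α≗β αX =
  cong₂ _∨_ (eval-coincide X φ co α≗β αX) (eval-coincide X ψ co α≗β αX)

module Runs {I : Set} {Δ : I → ChangeQuery} (P : DynPropProgram Δ) where

  ParamsIn : {n : ℕ} → (Fin n → Set) → Change Δ n → Set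
  ParamsIn X (chg c a) = ∀ i → X (a i)

  private
    join : ∀ {n p q} → (Fin p → Fin n) → (Fin q → Fin n) → Fin p ⊎ Fin q → Fin n
    join a t = [ a , t ]

    join-pointwise : ∀ {n p q} (a : Fin p → Fin n) {t t′ : Fin q → Fin n} →
                     (∀ j → t j ≡ t′ j) → ∀ v → join a t v ≡ join a t′ v
    join-pointwise a t≗t′ (inj₁ i) = refl
    join-pointwise a t≗t′ (inj₂ j) = t≗t′ j

    join-in : ∀ {n p q} (X : Fin n → Set) {a : Fin p → Fin n} {t : Fin q → Fin n} →
              (∀ i → X (a i)) → (∀ j → X (t j)) → ∀ v → X (join a t v)
    join-in X aX tX (inj₁ i) = aX i
    join-in X aX tX (inj₂ j) = tX j

  step-coincide : ∀ {n} (X : Fin n → Set) (ch : Change Δ n) → ParamsIn X ch →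
                  {S S′ : State P n} → Coincide X S S′ →
                  Coincide X (applyStep P ch S) (applyStep P ch S′)
  step-coincide X (chg c a) aX co E t≗t′ tX =
    eval-coincide X (μ (Δ c)) (λ _ → co E) (join-pointwise a t≗t′) (join-in X aX tX)
  step-coincide X (chg c a) aX co Q t≗t′ tX =
    eval-coincide X (upd P c Qa) co (join-pointwise a t≗t′) (join-in X aX tX)
  step-coincide X (chg c a) aX co (A i) t≗t′ tX =
    eval-coincide X (upd P c (Aa i)) co (join-pointwise a t≗t′) (join-in X aX tX)

  run-coincide : ∀ {n} (X : Fin n → Set) (cs : List (Change Δ n)) → All (ParamsIn X) cs →
                 {S S′ : State P n} → Coincide X S S′ → Coincide X (run P cs S) (run P cs S′)
  run-coincide X [] [] co = co
  run-coincide X (ch ∷ cs) (chX ∷ csX) co =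
    run-coincide X cs csX (step-coincide X ch chX co)

  reachable-extensional : ∀ {n} (cs : List (Change Δ n)) → Extensional (run P cs (initState P n))
  reachable-extensional cs =
    run-coincide (λ _ → ⊤) cs (universal (λ { (chg _ _) _ → tt }) cs) (λ _ _ _ → refl)

  run-++ : ∀ {n} (cs ds : List (Change Δ n)) (S : State P n) →
           run P (cs ++ ds) S ≡ run P ds (run P cs S)
  run-++ [] ds S = refl
  run-++ (ch ∷ cs) ds S = run-++ cs ds (applyStep P ch S)

arity-bound : {I : Set} {Δ : I → ChangeQuery} (P : DynPropProgram Δ) →
              Σ ℕ λ r → ∀ σ → par (ar P) σ ≤ r
arity-bound P with upper-bound (k P) (ar P)
... | b , bounds = 2 + b , λ { E → m≤m+n 2 b ; Q → m≤m+n 2 b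
                             ; (A i) → ≤-trans (bounds i) (m≤n+m b 2) }

-- A state restricted to the image of an embedding of a (suc m)-element set
-- is described by one of (2 ^ (suc m ^ r)) ^ (2 + k) codes: one bit for each
-- of the 2 + k symbols and each r-tuple of the small set (an ar(R)-tuple is
-- padded to an r-tuple).
module Codes {I : Set} {Δ : I → ChangeQuery} (P : DynPropProgram Δ)
             {m n : ℕ} (emb : Fin (suc m) → Fin n)
             (r : ℕ) (ar≤r : ∀ σ → par (ar P) σ ≤ r) where

  symbol : Fin (2 + k P) → PSym (k P)
  symbol zero = E
  symbol (suc zero) = Q
  symbol (suc (suc i)) = A i

  index : PSym (k P) → Fin (2 + k P)
  index E = zero
  index Q = suc zero
  index (A i) = suc (suc i)

  symbol-index : ∀ R → symbol (index R) ≡ R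
  symbol-index E = refl
  symbol-index Q = refl
  symbol-index (A i) = refl

  restrict : State P n → (R : PSym (k P)) → (Fin r → Fin (suc m)) → Bool
  restrict S R y = S R (λ j → emb (y (inject≤ j (ar≤r R))))

  entry : State P n → Fin (2 + k P) → Fin (suc m ^ r) → Fin 2
  entry S σ w = toBit (restrict S (symbol σ) (finToFun w))

  code : State P n → Fin ((2 ^ (suc m ^ r)) ^ (2 + k P))
  code S = funToFin λ σ → funToFin (entry S σ)

  code-coincide : ∀ {S S′} → Extensional S → Extensional S′ → code S ≡ code S′ →
                  Coincide (InImage emb) S S′
  code-coincide {S} {S′} extS extS′ same R {t} {t′} t≗t′ tX = begin
      S R t                             ≡⟨ extS R t≡padded (λ _ → tt) ⟩
      restrict S R y                    ≡⟨ cong (λ R′ → restrict S R′ y) (sym (symbol-index R)) ⟩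
      restrict S (symbol (index R)) y   ≡⟨ same-restriction (index R) (funToFin padded) ⟩
      restrict S′ (symbol (index R)) y  ≡⟨ cong (λ R′ → restrict S′ R′ y) (symbol-index R) ⟩
      restrict S′ R y                   ≡⟨ extS′ R (λ j → trans (sym (t≡padded j)) (t≗t′ j)) (λ _ → tt) ⟩
      S′ R t′                           ∎
    where
    open ≡-Reasoning
    padded : Fin r → Fin (suc m)
    padded = extend (ar≤r R) zero (λ j → proj₁ (tX j))
    y : Fin r → Fin (suc m)
    y = finToFun (funToFin padded)
    t≡padded : ∀ j → t j ≡ emb (y (inject≤ j (ar≤r R)))
    t≡padded j = sym (trans (cong emb (trans (finToFun-funToFin padded _)
                                              (extend-inject≤ (ar≤r R) zero (λ j → proj₁ (tX j)) j)))
                            (proj₂ (tX j)))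
    same-restriction : ∀ σ (w : Fin (suc m ^ r)) →
                       restrict S (symbol σ) (finToFun w) ≡ restrict S′ (symbol σ) (finToFun w)
    same-restriction σ w =
      toBit-injective (funToFin-injective (funToFin-injective {f = λ σ → funToFin (entry S σ)}
                                                              {g = λ σ → funToFin (entry S′ σ)} same σ) w)

HasEdges : {n : ℕ} → Graph n → (Fin n → Fin n → Bool) → Set
HasEdges G K = ∀ t → G tt t ≡ K (t zero) (t (suc zero))

HasEdges-cong : {n : ℕ} {G : Graph n} {K K′ : Fin n → Fin n → Bool} →
                HasEdges G K → (∀ x y → K x y ≡ K′ x y) → HasEdges G K′
HasEdges-cong hasK K≗K′ t = trans (hasK t) (K≗K′ _ _)

last-edge : {n : ℕ} {G : Graph n} {u v : Fin n} → Reach G u v →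
            u ≡ v ⊎ Σ (Fin n) λ w → G tt (pair w v) ≡ true
last-edge here = inj₁ refl
last-edge (step {w = w} u→w w⇝v) with last-edge w⇝v
... | inj₁ refl = inj₂ (_ , u→w)
... | inj₂ last = inj₂ last

isPair : {n : ℕ} → Fin n → Fin n → Fin n → Fin n → Bool
isPair p q x y = ⌊ x ≟ p ⌋ ∧ ⌊ y ≟ q ⌋

insert-edges : {n : ℕ} {G : Graph n} {K : Fin n → Fin n → Bool} {p q : Fin n} → HasEdges G K →
               HasEdges (applyChange insertE (pair p q) G) (λ x y → K x y ∨ isPair p q x y)
insert-edges hasK t = cong (_∨ _) (hasK _)

delete-edges : {n : ℕ} {G : Graph n} {K : Fin n → Fin n → Bool} {p q : Fin n} → HasEdges G K →
               HasEdges (applyChange deleteE (pair p q) G) (λ x y → K x y ∧ not (isPair p q x y))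
delete-edges hasK t = cong (_∧ _) (hasK _)

φ₀ : QF gar (Fin 1 ⊎ Fin 2)
φ₀ = ¬' E[ pv zero , xv ]

ρ₀ : ChangeQuery
ρ₀ = deletionQuery 1 φ₀

ρ₀-edges : {n : ℕ} {G : Graph n} {K : Fin n → Fin n → Bool} {a : Fin n} → HasEdges G K →
           HasEdges (applyChange ρ₀ (λ _ → a) G) (λ x y → K x y ∧ not (K a x))
ρ₀-edges hasK t = cong₂ (λ u v → u ∧ not v) (hasK _) (hasK _)

-- inserting resp. deleting the edge c overwrites its entry by true resp. false
∨-as-if : ∀ b c → (b ∨ c) ≡ (if c then true else b)
∨-as-if b true = ∨-zeroʳ b
∨-as-if b false = ∨-identityʳ b

∧-not-as-if : ∀ b c → (b ∧ not c) ≡ (if c then false else b)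
∧-not-as-if b true = ∧-zeroʳ b
∧-not-as-if b false = ∧-identityʳ b

module Construction {ρ : ChangeQuery} (P : DynPropProgram (ΔEρ ρ)) {n : ℕ} where

  input : State P n → Graph n
  input = inputOf {P = P}

  overwrite : (Fin n → Fin n → Bool) → Fin n → Fin n → Bool → Fin n → Fin n → Bool
  overwrite K p q b x y = if isPair p q x y then b else K x y

  overwrite-here : ∀ (K : Fin n → Fin n → Bool) p q b → overwrite K p q b p q ≡ b
  overwrite-here K p q b with p ≟ p | q ≟ q
  ... | yes _ | yes _ = refl
  ... | no p≢p | _ = ⊥-elim (p≢p refl)
  ... | yes _ | no q≢q = ⊥-elim (q≢q refl)

  overwrite-agrees : ∀ (H K : Fin n → Fin n → Bool) p q x y →
                     K x y ≡ H x y → overwrite K p q (H p q) x y ≡ H x y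
  overwrite-agrees H K p q x y K≡H with x ≟ p | y ≟ q
  ... | yes refl | yes refl = refl
  ... | yes _ | no _ = K≡H
  ... | no _ | _ = K≡H

  setEdge : Bool → Fin n → Fin n → Change (ΔEρ ρ) n
  setEdge true p q = chg ins (pair p q)
  setEdge false p q = chg del (pair p q)

  setEdge-edges : ∀ b p q {S K} → HasEdges (input S) K →
                  HasEdges (input (applyStep P (setEdge b p q) S)) (overwrite K p q b)
  setEdge-edges true p q {K = K} hasK =
    HasEdges-cong (insert-edges {K = K} hasK) (λ x y → ∨-as-if (K x y) (isPair p q x y))
  setEdge-edges false p q {K = K} hasK =
    HasEdges-cong (delete-edges {K = K} hasK) (λ x y → ∧-not-as-if (K x y) (isPair p q x y))

  setEdgeOf : (Fin n → Fin n → Bool) → Fin n × Fin n → Change (ΔEρ ρ) n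
  setEdgeOf H (p , q) = setEdge (H p q) p q

  setEdges-edges : ∀ H (ps : List (Fin n × Fin n)) {S K} → HasEdges (input S) K →
                   (∀ x y → (x , y) ∈ ps ⊎ K x y ≡ H x y) →
                   HasEdges (input (run P (map (setEdgeOf H) ps) S)) H
  setEdges-edges H [] {K = K} hasK covered =
    HasEdges-cong {K = K} hasK (λ x y → [ (λ ()) , (λ K≡H → K≡H) ]′ (covered x y))
  setEdges-edges H ((p , q) ∷ ps) {S} {K} hasK covered =
    setEdges-edges H ps {S = applyStep P (setEdge (H p q) p q) S} {K = overwrite K p q (H p q)}
                   (setEdge-edges (H p q) p q {S} {K} hasK) covered′
    where
    covered′ : ∀ x y → (x , y) ∈ ps ⊎ overwrite K p q (H p q) x y ≡ H x y
    covered′ x y with covered x y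
    ... | inj₁ (here refl) = inj₂ (overwrite-here K p q (H p q))
    ... | inj₁ (there xy∈ps) = inj₁ xy∈ps
    ... | inj₂ K≡H = inj₂ (overwrite-agrees H K p q x y K≡H)

  allPairs : List (Fin n × Fin n)
  allPairs = cartesianProduct (allFin n) (allFin n)

  construct : (Fin n → Fin n → Bool) → List (Change (ΔEρ ρ) n)
  construct H = map (setEdgeOf H) allPairs

  construct-edges : ∀ H → HasEdges (input (run P (construct H) (initState P n))) H
  construct-edges H = setEdges-edges H allPairs {K = λ _ _ → false} (λ _ → refl)
    (λ x y → inj₁ (∈-cartesianProduct⁺ (∈-allFin x) (∈-allFin y)))

∧-true : ∀ {x y} → x ∧ y ≡ true → x ≡ true × y ≡ true
∧-true {true} {true} _ = refl , refl
∧-true {true} {false} ()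
∧-true {false} ()

≟ᵇ-refl : ∀ x → ⌊ x ≟ᵇ x ⌋ ≡ true
≟ᵇ-refl true = refl
≟ᵇ-refl false = refl

≟ᵇ-not : ∀ x → ⌊ x ≟ᵇ not x ⌋ ≡ false
≟ᵇ-not true = refl
≟ᵇ-not false = refl

not-complement : ∀ {x y} → not ⌊ x ≟ᵇ not y ⌋ ≡ true → x ≡ y
not-complement {true} {true} _ = refl
not-complement {false} {false} _ = refl
not-complement {true} {false} ()
not-complement {false} {true} ()

-- The gadget graph.

module Gadgets (c′ : ℕ) where

  c m G n : ℕ
  c = suc c′
  m = suc (c + c)
  G = 2 ^ c
  n = m + G

  bits : Fin G → Fin c → Bool
  bits g i = fromBit (finToFun g i)

  bits-injective : ∀ {g g′} → (∀ i → bits g i ≡ bits g′ i) → g ≡ g′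
  bits-injective same = finToFun-injective (λ i → fromBit-injective (same i))

  data Kind : Set where
    target : Kind
    core   : Fin c → Bool → Kind
    gadget : Fin G → Kind

  coreIndex : Fin c → Bool → Fin m
  coreIndex i false = suc (i ↑ˡ c)
  coreIndex i true = suc (c ↑ʳ i)

  embedCore : Fin m → Fin n
  embedCore y = y ↑ˡ G

  vertex : Kind → Fin n
  vertex target = embedCore zero
  vertex (core i b) = embedCore (coreIndex i b)
  vertex (gadget g) = m ↑ʳ g

  private
    coreKind : Fin c ⊎ Fin c → Kind
    coreKind (inj₁ i) = core i false
    coreKind (inj₂ i) = core i true

    smallKind : Fin m → Kind
    smallKind zero = target
    smallKind (suc y) = coreKind (splitAt c y)

    kindOfSplit : Fin m ⊎ Fin G → Kind
    kindOfSplit (inj₁ y) = smallKind y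
    kindOfSplit (inj₂ g) = gadget g

  kind : Fin n → Kind
  kind x = kindOfSplit (splitAt m x)

  kind-vertex : ∀ κ → kind (vertex κ) ≡ κ
  kind-vertex target = refl
  kind-vertex (core i b) =
    trans (cong kindOfSplit (splitAt-↑ˡ m (coreIndex i b) G)) (smallKind-core b)
    where
    smallKind-core : ∀ b → smallKind (coreIndex i b) ≡ core i b
    smallKind-core false = cong coreKind (splitAt-↑ˡ c i c)
    smallKind-core true = cong coreKind (splitAt-↑ʳ c c i)
  kind-vertex (gadget g) = cong kindOfSplit (splitAt-↑ʳ m G g)

  vertex-injective : ∀ {κ κ′} → vertex κ ≡ vertex κ′ → κ ≡ κ′
  vertex-injective {κ} {κ′} same =
    trans (sym (kind-vertex κ)) (trans (cong kind same) (kind-vertex κ′))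

  InCore : Fin n → Set
  InCore = InImage embedCore

  target-in-core : InCore (vertex target)
  target-in-core = zero , refl

  core-in-core : ∀ i b → InCore (vertex (core i b))
  core-in-core i b = coreIndex i b , refl

  gadgetEdges : (Fin G → Bool) → Kind → Kind → Bool
  gadgetEdges live (core i b) (gadget g) = ⌊ bits g i ≟ᵇ b ⌋
  gadgetEdges live (gadget g) target = live g
  gadgetEdges live _ _ = false

  graphOf : (Fin G → Bool) → Fin n → Fin n → Bool
  graphOf live x y = gadgetEdges live (kind x) (kind y)

  edge-between : ∀ {G′ : Graph n} {live} → HasEdges G′ (graphOf live) →
                 ∀ κ κ′ → G′ tt (pair (vertex κ) (vertex κ′)) ≡ gadgetEdges live κ κ′
  edge-between {live = live} hasK κ κ′ =
    trans (hasK _) (cong₂ (gadgetEdges live) (kind-vertex κ) (kind-vertex κ′))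

  no-edge-into-target : ∀ live → (∀ g → live g ≡ false) → ∀ κ → gadgetEdges live κ target ≡ false
  no-edge-into-target live dead target = refl
  no-edge-into-target live dead (core i b) = refl
  no-edge-into-target live dead (gadget g) = dead g

  kill : Fin c → Bool → (Fin G → Bool) → Fin G → Bool
  kill i b live g = live g ∧ not ⌊ bits g i ≟ᵇ b ⌋

  kill-edges : ∀ live i b κ κ′ →
               (gadgetEdges live κ κ′ ∧ not (gadgetEdges live (core i b) κ))
                 ≡ gadgetEdges (kill i b live) κ κ′
  kill-edges live i b target κ′ = refl
  kill-edges live i b (core _ _) target = refl
  kill-edges live i b (core _ _) (core _ _) = refl
  kill-edges live i b (core _ _) (gadget g) = ∧-identityʳ _
  kill-edges live i b (gadget g) target = refl
  kill-edges live i b (gadget g) (core _ _) = refl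
  kill-edges live i b (gadget g) (gadget _) = refl

  survivors : Fin G → List (Fin c) → (Fin G → Bool) → Fin G → Bool
  survivors g₀ [] live = live
  survivors g₀ (i ∷ is) live = survivors g₀ is (kill i (not (bits g₀ i)) live)

  survivors-target : ∀ g₀ is live → survivors g₀ is live g₀ ≡ live g₀
  survivors-target g₀ [] live = refl
  survivors-target g₀ (i ∷ is) live =
    trans (survivors-target g₀ is _)
          (trans (cong (λ d → live g₀ ∧ not d) (≟ᵇ-not (bits g₀ i))) (∧-identityʳ (live g₀)))

  survivors-live : ∀ g₀ is live g → survivors g₀ is live g ≡ true → live g ≡ true
  survivors-live g₀ [] live g alive = alive
  survivors-live g₀ (i ∷ is) live g alive = proj₁ (∧-true (survivors-live g₀ is _ g alive))

  survivors-agree : ∀ g₀ is live g → survivors g₀ is live g ≡ true →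
                    ∀ i → i ∈ is → bits g i ≡ bits g₀ i
  survivors-agree g₀ (i ∷ is) live g alive i (here refl) =
    not-complement (proj₂ (∧-true (survivors-live g₀ is _ g alive)))
  survivors-agree g₀ (j ∷ is) live g alive i (there i∈is) = survivors-agree g₀ is _ g alive i i∈is

  survivors-unique : ∀ g₀ live g → survivors g₀ (allFin c) live g ≡ true → g ≡ g₀
  survivors-unique g₀ live g alive =
    bits-injective (λ i → survivors-agree g₀ (allFin c) live g alive i (∈-allFin i))

  survivors-dead : ∀ g₀ live → live g₀ ≡ false → ∀ g → survivors g₀ (allFin c) live g ≡ false
  survivors-dead g₀ live dead g with survivors g₀ (allFin c) live g in alive
  ... | false = refl
  ... | true with survivors-unique g₀ live g alive
  ...   | refl = trans (sym alive) (trans (survivors-target g₀ (allFin c) live) dead)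

  module Fooling (P : DynPropProgram (ΔEρ ρ₀)) (maint : MaintainsReach P) where
    open Runs P
    open Construction P {n}

    probe : Fin c → Bool → Change (ΔEρ ρ₀) n
    probe i b = chg rho (λ _ → vertex (core i b))

    probe-edges : ∀ i b {S live} → HasEdges (input S) (graphOf live) →
                  HasEdges (input (applyStep P (probe i b) S)) (graphOf (kill i b live))
    probe-edges i b {S} {live} hasK =
      HasEdges-cong (ρ₀-edges {K = graphOf live} hasK) λ x y →
        trans (cong (λ κ → graphOf live x y ∧ not (gadgetEdges live κ (kind x)))
                    (kind-vertex (core i b)))
              (kill-edges live i b (kind x) (kind y))

    probes : Fin G → List (Fin c) → List (Change (ΔEρ ρ₀) n)
    probes g₀ is = map (λ i → probe i (not (bits g₀ i))) is

    probes-edges : ∀ g₀ is {S live} → HasEdges (input S) (graphOf live) →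
                   HasEdges (input (run P (probes g₀ is) S)) (graphOf (survivors g₀ is live))
    probes-edges g₀ [] hasK = hasK
    probes-edges g₀ (i ∷ is) {S} {live} hasK =
      probes-edges g₀ is {applyStep P (probe i (not (bits g₀ i))) S} {kill i (not (bits g₀ i)) live}
                   (probe-edges i _ {S} {live} hasK)

    probes-in-core : ∀ g₀ is → All (ParamsIn InCore) (probes g₀ is)
    probes-in-core g₀ [] = []
    probes-in-core g₀ (i ∷ is) = (λ _ → core-in-core i _) ∷ probes-in-core g₀ is

    built : (Fin G → Bool) → State P n
    built live = run P (construct (graphOf live)) (initState P n)

    probed : (Fin G → Bool) → Fin G → State P n
    probed live g₀ = run P (probes g₀ (allFin c)) (built live)

    probed-edges : ∀ live g₀ →
                   HasEdges (input (probed live g₀)) (graphOf (survivors g₀ (allFin c) live))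
    probed-edges live g₀ =
      probes-edges g₀ (allFin c) {built live} {live} (construct-edges (graphOf live))

    source : Fin G → Fin n
    source g₀ = vertex (core zero (bits g₀ zero))

    reach-if-live : ∀ live g₀ → live g₀ ≡ true →
                    Reach (input (probed live g₀)) (source g₀) (vertex target)
    reach-if-live live g₀ alive = step into-gadget (step into-target here)
      where
      into-gadget : input (probed live g₀) tt (pair (source g₀) (vertex (gadget g₀))) ≡ true
      into-gadget = trans (edge-between (probed-edges live g₀) (core zero (bits g₀ zero)) (gadget g₀))
                          (≟ᵇ-refl (bits g₀ zero))
      into-target : input (probed live g₀) tt (pair (vertex (gadget g₀)) (vertex target)) ≡ true
      into-target = trans (edge-between (probed-edges live g₀) (gadget g₀) target)
                          (trans (survivors-target g₀ (allFin c) live) alive)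

    no-reach-if-dead : ∀ live g₀ → live g₀ ≡ false →
                       ¬ Reach (input (probed live g₀)) (source g₀) (vertex target)
    no-reach-if-dead live g₀ dead reach with last-edge reach
    ... | inj₁ source≡target with vertex-injective {core zero (bits g₀ zero)} {target} source≡target
    ...   | ()
    no-reach-if-dead live g₀ dead reach | inj₂ (w , w→target) with
      trans (sym w→target) (trans (probed-edges live g₀ _)
        (no-edge-into-target _ (survivors-dead g₀ live dead) (kind w)))
    ... | ()

    answer : (Fin G → Bool) → Fin G → Bool
    answer live g₀ = probed live g₀ Q (pair (source g₀) (vertex target))

    Answers : State P n → Fin n → Fin n → Set
    Answers S u v = (S Q (pair u v) ≡ true → Reach (input S) u v) ×
                    (Reach (input S) u v → S Q (pair u v) ≡ true)

    answer-correct : ∀ live g₀ → Answers (probed live g₀) (source g₀) (vertex target)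
    answer-correct live g₀ =
      subst (λ S → Answers S (source g₀) (vertex target))
            (run-++ (construct (graphOf live)) (probes g₀ (allFin c)) (initState P n))
            (maint n _ nonempty (source g₀) (vertex target))
      where
      nonempty : construct (graphOf live) ++ probes g₀ (allFin c) ≢ []
      nonempty empty with ++-conicalˡ (construct (graphOf live)) _ empty
      ... | ()

    -- all probe parameters and the queried pair lie in the core, so the
    -- answer only depends on the built state restricted to the core
    answer-local : ∀ live live′ g₀ → Coincide InCore (built live) (built live′) →
                   answer live g₀ ≡ answer live′ g₀
    answer-local live live′ g₀ co =
      run-coincide InCore (probes g₀ (allFin c)) (probes-in-core g₀ (allFin c)) co
                   Q (λ _ → refl) query-in-core
      where
      query-in-core : ∀ i → InCore (pair (source g₀) (vertex target) i)
      query-in-core zero = core-in-core zero (bits g₀ zero)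
      query-in-core (suc zero) = target-in-core

    distinguishes : ∀ live live′ g₀ → live g₀ ≡ true → live′ g₀ ≡ false →
                    answer live g₀ ≢ answer live′ g₀
    distinguishes live live′ g₀ alive dead same =
      no-reach-if-dead live′ g₀ dead (proj₁ (answer-correct live′ g₀) (trans (sym same) yes-answer))
      where
      yes-answer : answer live g₀ ≡ true
      yes-answer = proj₂ (answer-correct live g₀) (reach-if-live live g₀ alive)

    fooled : ∀ live live′ → Coincide InCore (built live) (built live′) → ∀ g → live g ≡ live′ g
    fooled live live′ co g with live g in e | live′ g in e′
    ... | true | true = refl
    ... | false | false = refl
    ... | true | false = ⊥-elim (distinguishes live live′ g e e′ (answer-local live live′ g co))
    ... | false | true = ⊥-elim (distinguishes live′ live g e′ e (sym (answer-local live live′ g co)))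

    -- but there are more live sets than codes of core restrictions
    no-program : (r : ℕ) (ar≤r : ∀ σ → par (ar P) σ ≤ r) → (2 ^ (m ^ r)) ^ (2 + k P) < 2 ^ G → ⊥
    no-program r ar≤r few =
      let (β , β′ , β<β′ , same) = pigeonhole few (λ β → code (built (liveOf β)))
      in <⇒≢ β<β′ (code-injective same)
      where
      open Codes P embedCore r ar≤r

      liveOf : Fin (2 ^ G) → Fin G → Bool
      liveOf β g = fromBit (finToFun β g)

      code-injective : ∀ {β β′} → code (built (liveOf β)) ≡ code (built (liveOf β′)) → β ≡ β′
      code-injective {β} {β′} same =
        finToFun-injective {G} {2} λ g → fromBit-injective (fooled (liveOf β) (liveOf β′) core-equal g)
        where
        built-extensional : ∀ β → Extensional (built (liveOf β))
        built-extensional β = reachable-extensional (construct (graphOf (liveOf β)))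
        core-equal : Coincide InCore (built (liveOf β)) (built (liveOf β′))
        core-equal = code-coincide (built-extensional β) (built-extensional β′) same

no-DynProp-program : (P : DynPropProgram (ΔEρ ρ₀)) → MaintainsReach P → ⊥
no-DynProp-program P maint =
  let (r , ar≤r) = arity-bound P
      (c′ , small) = polynomial<exponential (2 + k P) r
      open Gadgets c′
  in Fooling.no-program P maint r ar≤r (fewer-codes (m ^ r) (2 + k P) (2 ^ c) small)

theorem12 : Σ (QF gar (Fin 1 ⊎ Fin 2)) λ φ → ¬ DynPropMaintainable (ΔEρ (deletionQuery 1 φ))
theorem12 = φ₀ , λ (P , maint) → no-DynProp-program P maint
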